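{- Let $G=(V,E)$ be a very basic graph. Then Breaker has a strategy to prevent Maker from claiming all three edges of any triangle in the unbiased Maker-Breaker game on $E(G)$, even if Maker is allowed to claim two edges in the very first round.
   Context: For a graph $G$ without isolated vertices, let $T_G$ be the graph whose vertices are the triangles (subgraphs isomorphic to $K_3$) of $G$, two triangles being adjacent in $T_G$ if they share an edge. $G$ is called very basic if $T_G$ is isomorphic to a subgraph of $K_3^+$ (a triangle with one pendant edge attached) or to a subgraph of a path $P_k$ for some $k\in\mathbb{N}$. In the unbiased Maker-Breaker game on $E(G)$, Maker and Breaker alternately claim one unclaimed edge each (Maker first), until all edges are claimed. -}

module Defs where

open import Data.Nat using (ℕ; suc)
open import Data.Fin using (Fin; toℕ; _<_)
open import Data.Bool using (Bool; true; false)
open import Data.Product using (Σ; ∃; ∃-syntax; _×_; _,_)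
open import Data.Sum using (_⊎_)
open import Data.List using (List; _∷_; [])
open import Data.List.Membership.Propositional using (_∈_)
open import Relation.Binary.PropositionalEquality using (_≡_; _≢_)
open import Relation.Nullary using (¬_)

record Graph (n : ℕ) : Set where
  field
    adj    : Fin n → Fin n → Bool
    sym    : ∀ u v → adj u v ≡ adj v u
    irrefl : ∀ v → adj v v ≡ false
open Graph public

module _ {n : ℕ} (G : Graph n) where

  NoIsolatedVertices : Set
  NoIsolatedVertices = ∀ v → ∃[ u ] (adj G v u ≡ true)

  -- An edge {u,v} is represented canonically by the ordered pair (u , v) with u < v.
  IsEdge : Fin n → Fin n → Set
  IsEdge u v = (u < v) × (adj G u v ≡ true)

  IsTriangle : Fin n × Fin n × Fin n → Set
  IsTriangle (a , b , c) = (a < b) × (b < c) ×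
    (adj G a b ≡ true) × (adj G a c ≡ true) × (adj G b c ≡ true)

  Triangle : Set
  Triangle = Σ (Fin n × Fin n × Fin n) IsTriangle

  vertsOf : Triangle → Fin n × Fin n × Fin n
  vertsOf (t , _) = t

  _∈T_ : Fin n → Triangle → Set
  x ∈T ((a , b , c) , _) = (x ≡ a) ⊎ (x ≡ b) ⊎ (x ≡ c)

  -- Adjacency in T_G: two distinct triangles sharing an edge.
  TAdj : Triangle → Triangle → Set
  TAdj t s = (vertsOf t ≢ vertsOf s) ×
    (∃[ x ] ∃[ y ] (x < y) × (x ∈T t) × (y ∈T t) × (x ∈T s) × (y ∈T s))

-- K3+ : vertices 0,1,2 form a triangle, vertex 3 is a pendant attached to 0.
K3+Adj : Fin 4 → Fin 4 → Set
K3+Adj u v = K u v ⊎ K v u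
  where
  K : Fin 4 → Fin 4 → Set
  K u v = ((toℕ u ≡ 0) × (toℕ v ≡ 1)) ⊎ ((toℕ u ≡ 0) × (toℕ v ≡ 2))
        ⊎ ((toℕ u ≡ 1) × (toℕ v ≡ 2)) ⊎ ((toℕ u ≡ 0) × (toℕ v ≡ 3))

PathAdj : (k : ℕ) → Fin k → Fin k → Set
PathAdj k u v = (suc (toℕ u) ≡ toℕ v) ⊎ (suc (toℕ v) ≡ toℕ u)

module _ {n : ℕ} (G : Graph n) where

  -- T_G is isomorphic to a subgraph of H (on vertex set V with adjacency HAdj):
  -- an injective, adjacency-preserving map from the triangles of G into V.
  TGEmbedsInto : (V : Set) → (V → V → Set) → Set
  TGEmbedsInto V HAdj = Σ (Triangle G → V) λ f →
    (∀ t s → f t ≡ f s → vertsOf G t ≡ vertsOf G s) ×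
    (∀ t s → TAdj G t s → HAdj (f t) (f s))

  VeryBasic : Set
  VeryBasic = TGEmbedsInto (Fin 4) K3+Adj ⊎ (∃[ k ] TGEmbedsInto (Fin k) (PathAdj k))

  -- Game positions: lists of edges claimed by Maker (M) and Breaker (B).
  Claims : Set
  Claims = List (Fin n × Fin n)

  Unclaimed : Claims → Claims → Fin n → Fin n → Set
  Unclaimed M B u v = IsEdge G u v × ¬ ((u , v) ∈ M) × ¬ ((u , v) ∈ B)

  MakerHasTriangle : Claims → Set
  MakerHasTriangle M = ∃[ a ] ∃[ b ] ∃[ c ] (a < b) × (b < c) ×
    ((a , b) ∈ M) × ((a , c) ∈ M) × ((b , c) ∈ M)

  -- Breaker has a strategy guaranteeing Maker never owns all edges of a triangle,
  -- from the given position, with Maker (resp. Breaker) to move.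
  -- (Inductive: the game is finite, so this is existence of a winning strategy.)
  data BreakerWinsMakerToMove (M B : Claims) : Set
  data BreakerWinsBreakerToMove (M B : Claims) : Set

  data BreakerWinsMakerToMove M B where
    makerMoves : ¬ MakerHasTriangle M →
      (∀ u v → Unclaimed M B u v → BreakerWinsBreakerToMove ((u , v) ∷ M) B) →
      BreakerWinsMakerToMove M B

  data BreakerWinsBreakerToMove M B where
    gameOver : ¬ MakerHasTriangle M →
      (∀ u v → ¬ Unclaimed M B u v) →
      BreakerWinsBreakerToMove M B
    breakerMoves : ¬ MakerHasTriangle M → ∀ u v → Unclaimed M B u v →
      BreakerWinsMakerToMove M ((u , v) ∷ B) →
      BreakerWinsBreakerToMove M B

module Submission where

-- Breaker plays a pairing strategy (PairingStrategy): if each triangle has at least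
-- two reserved sides, none of them e₀ and no edge reserved for two triangles, Breaker
-- answers every Maker move on an edge reserved for an intact triangle by claiming
-- another edge reserved for it.  Such a pairing comes from a potential (Potentials):
-- a function d on triangles separating neighbours across sides other than e₀, with no
-- lower neighbours of triangles through e₀, and lower neighbours of any triangle across
-- one side only; each triangle reserves its sides other than e₀ not shared with a lower
-- triangle.  If T_G embeds in a path, the distance to a triangle through e₀ is a
-- potential (PathCase); if T_G embeds in K3+, a ranking of the four labels is one,
-- found by an exhaustive check over the configurations of K3+ (K3+, K3+Case) and using
-- that T_G contains no K₄.

open import Defs hiding (sym)
open import Data.Nat as ℕ using (ℕ; zero; suc; z≤n; s≤s; ∣_-_∣)
import Data.Nat.Properties as ℕ
open import Data.Fin using (Fin; toℕ; _<_; zero; suc)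
open import Data.Fin.Properties using (<-irrefl; <-asym; <-trans; <-cmp; <-irrelevant; _≟_; _<?_; toℕ-injective; any?; all?)
open import Data.Bool using (Bool; true; T)
open import Data.Maybe using (Maybe; just; nothing)
import Data.Maybe.Properties as Maybe
open import Data.Vec using (Vec; lookup; tabulate; _∷_; [])
open import Data.Vec.Properties using (lookup∘tabulate)
open import Data.Fin.Subset using (Subset)
open import Data.Fin.Subset.Properties using (anySubset?)
open import Data.Unit using (tt)
import Data.Bool.Properties as Bool
open import Data.Product using (Σ; _×_; _,_; proj₁; proj₂; uncurry)
import Data.Product.Properties as Product
open import Data.Sum using (_⊎_; inj₁; inj₂; assocˡ)
open import Data.Empty using (⊥; ⊥-elim)
open import Function using (_∘_)
open import Data.List using (List; _∷_; []; allFin; cartesianProduct)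
open import Data.List.Membership.Propositional using (_∈_; find)
open import Data.List.Membership.Propositional.Properties using (∈-cartesianProduct⁺; ∈-allFin)
open import Data.List.Relation.Unary.Any as Any using (Any; here; there)
open import Relation.Binary.Definitions using (tri<; tri≈; tri>)
open import Relation.Binary.PropositionalEquality using (_≡_; _≢_; refl; sym; trans; cong; subst; ≢-sym)
open import Relation.Nullary using (¬_; Dec; yes; no; contradiction)
open import Relation.Nullary.Decidable using (_×-dec_; _⊎-dec_; _→-dec_; map′; ¬?; T?; isYes; toWitness; fromWitness; decidable-stable)
open import Axiom.UniquenessOfIdentityProofs using (module Decidable⇒UIP)

module Geometry {n : ℕ} (G : Graph n) where

  Edge : Set
  Edge = Fin n × Fin n

  Tri : Set
  Tri = Triangle G

  V : Tri → Fin n × Fin n × Fin n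
  V = vertsOf G

  infix 4 _∈△_
  _∈△_ : Fin n → Tri → Set
  x ∈△ t = _∈T_ G x t

  data SideOf : Edge → Tri → Set where
    side : {u v : Fin n} {t : Tri} → u < v → u ∈△ t → v ∈△ t → SideOf (u , v) t

  <⇒≢ : {x y : Fin n} → x < y → x ≢ y
  <⇒≢ x<y refl = <-irrefl refl x<y

  adj-sym : {x y : Fin n} → adj G x y ≡ true → adj G y x ≡ true
  adj-sym {x} {y} e = trans (Graph.sym G y x) e

  -- A triangle is determined by its vertex triple: the remaining data are proofs
  -- of propositions (order and adjacency facts).
  triangle-≡ : (t s : Tri) → V t ≡ V s → t ≡ s
  triangle-≡ (v , p) (.v , q) refl = cong (v ,_) (irrelevant p q)
    where
    bool-uip : {b : Bool} (p q : b ≡ true) → p ≡ q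
    bool-uip = Decidable⇒UIP.≡-irrelevant Bool._≟_
    irrelevant : ∀ {v} (p q : IsTriangle G v) → p ≡ q
    irrelevant (p₁ , p₂ , p₃ , p₄ , p₅) (q₁ , q₂ , q₃ , q₄ , q₅)
      rewrite <-irrelevant p₁ q₁ | <-irrelevant p₂ q₂
            | bool-uip p₃ q₃ | bool-uip p₄ q₄ | bool-uip p₅ q₅ = refl

  transport : (P : Tri → Set) {t s : Tri} → V t ≡ V s → P t → P s
  transport P {t} {s} eq = subst P (triangle-≡ t s eq)

  respects-V : {A : Set} (f : Tri → A) {t s : Tri} → V t ≡ V s → f t ≡ f s
  respects-V f {t} {s} eq = cong f (triangle-≡ t s eq)

  separated-by : {t s : Tri} {x : Fin n} → x ∈△ t → ¬ x ∈△ s → V t ≢ V s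
  separated-by {t} {s} {x} x∈t x∉s eq = x∉s (transport (x ∈△_) {t} {s} eq x∈t)

  _≟ₑ_ : (x y : Edge) → Dec (x ≡ y)
  _≟ₑ_ = Product.≡-dec _≟_ _≟_

  _≟V_ : (t s : Tri) → Dec (V t ≡ V s)
  t ≟V s = Product.≡-dec _≟_ (Product.≡-dec _≟_ _≟_) (V t) (V s)

  _∈△?_ : ∀ x t → Dec (x ∈△ t)
  x ∈△? ((a , b , c) , _) = (x ≟ a) ⊎-dec (x ≟ b) ⊎-dec (x ≟ c)

  side? : ∀ x t → Dec (SideOf x t)
  side? (u , v) t = map′ (λ (u<v , u∈t , v∈t) → side u<v u∈t v∈t)
    (λ { (side u<v u∈t v∈t) → u<v , u∈t , v∈t }) ((u <? v) ×-dec (u ∈△? t) ×-dec (v ∈△? t))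

  any-triangle? : {P : Tri → Set} → (∀ t → Dec (P t)) → Dec (Σ Tri P)
  any-triangle? {P} P? =
    map′ (λ (a , b , c , p , q) → ((a , b , c) , p) , q) (λ (((a , b , c) , p) , q) → a , b , c , p , q)
      (any? λ a → any? λ b → any? λ c → on (a , b , c))
    where
    is-triangle? : ∀ v → Dec (IsTriangle G v)
    is-triangle? (a , b , c) = (a <? b) ×-dec (b <? c) ×-dec (adj G a b Bool.≟ true)
      ×-dec (adj G a c Bool.≟ true) ×-dec (adj G b c Bool.≟ true)
    on : ∀ v → Dec (Σ (IsTriangle G v) λ p → P (v , p))
    on v with is-triangle? v
    ... | no ¬p = no λ (p , _) → ¬p p
    ... | yes p with P? (v , p)
    ...   | yes q = yes (p , q)
    ...   | no ¬q = no λ (p′ , q′) → ¬q (transport P {v , p′} {v , p} refl q′)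

  private
    Among : Fin n → Fin n × Fin n × Fin n → Set
    Among x (a , b , c) = (x ≡ a) ⊎ (x ≡ b) ⊎ (x ≡ c)

    sorted-≡ : {a b c a′ b′ c′ : Fin n} → a < b → b < c → a′ < b′ → b′ < c′ →
      Among a (a′ , b′ , c′) → Among b (a′ , b′ , c′) → Among c (a′ , b′ , c′) →
      (a , b , c) ≡ (a′ , b′ , c′)
    sorted-≡ ab bc _ _ (inj₁ refl) (inj₁ refl) _ = ⊥-elim (<⇒≢ ab refl)
    sorted-≡ ab bc _ _ (inj₁ refl) (inj₂ (inj₁ refl)) (inj₁ refl) = ⊥-elim (<-asym ab bc)
    sorted-≡ ab bc _ _ (inj₁ refl) (inj₂ (inj₁ refl)) (inj₂ (inj₁ refl)) = ⊥-elim (<⇒≢ bc refl)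
    sorted-≡ ab bc _ _ (inj₁ refl) (inj₂ (inj₁ refl)) (inj₂ (inj₂ refl)) = refl
    sorted-≡ ab bc _ _ (inj₁ refl) (inj₂ (inj₂ refl)) (inj₁ refl) = ⊥-elim (<-asym ab bc)
    sorted-≡ ab bc _ b′c′ (inj₁ refl) (inj₂ (inj₂ refl)) (inj₂ (inj₁ refl)) = ⊥-elim (<-asym bc b′c′)
    sorted-≡ ab bc _ _ (inj₁ refl) (inj₂ (inj₂ refl)) (inj₂ (inj₂ refl)) = ⊥-elim (<⇒≢ bc refl)
    sorted-≡ ab bc a′b′ _ (inj₂ (inj₁ refl)) (inj₁ refl) _ = ⊥-elim (<-asym ab a′b′)
    sorted-≡ ab bc _ _ (inj₂ (inj₁ refl)) (inj₂ (inj₁ refl)) _ = ⊥-elim (<⇒≢ ab refl)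
    sorted-≡ ab bc a′b′ b′c′ (inj₂ (inj₁ refl)) (inj₂ (inj₂ refl)) (inj₁ refl) = ⊥-elim (<-asym (<-trans a′b′ b′c′) bc)
    sorted-≡ ab bc _ b′c′ (inj₂ (inj₁ refl)) (inj₂ (inj₂ refl)) (inj₂ (inj₁ refl)) = ⊥-elim (<-asym bc b′c′)
    sorted-≡ ab bc _ _ (inj₂ (inj₁ refl)) (inj₂ (inj₂ refl)) (inj₂ (inj₂ refl)) = ⊥-elim (<⇒≢ bc refl)
    sorted-≡ ab bc a′b′ b′c′ (inj₂ (inj₂ refl)) (inj₁ refl) _ = ⊥-elim (<-asym (<-trans a′b′ b′c′) ab)
    sorted-≡ ab bc _ b′c′ (inj₂ (inj₂ refl)) (inj₂ (inj₁ refl)) _ = ⊥-elim (<-asym ab b′c′)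
    sorted-≡ ab bc _ _ (inj₂ (inj₂ refl)) (inj₂ (inj₂ refl)) _ = ⊥-elim (<⇒≢ ab refl)

  vertices-in⇒≡ : (t s : Tri) → (∀ x → x ∈△ t → x ∈△ s) → V t ≡ V s
  vertices-in⇒≡ ((a , b , c) , ab , bc , _) ((_ , _ , _) , a′b′ , b′c′ , _) ⊆ =
    sorted-≡ ab bc a′b′ b′c′ (⊆ a (inj₁ refl)) (⊆ b (inj₂ (inj₁ refl))) (⊆ c (inj₂ (inj₂ refl)))

  members-adjacent : (t : Tri) {u v : Fin n} → u ∈△ t → v ∈△ t → u ≢ v → adj G u v ≡ true
  members-adjacent ((a , b , c) , _ , _ , ab , ac , bc) = go
    where
    go : ∀ {u v} → (u ≡ a) ⊎ (u ≡ b) ⊎ (u ≡ c) → (v ≡ a) ⊎ (v ≡ b) ⊎ (v ≡ c) → u ≢ v → adj G u v ≡ true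
    go (inj₁ refl) (inj₂ (inj₁ refl)) _ = ab
    go (inj₁ refl) (inj₂ (inj₂ refl)) _ = ac
    go (inj₂ (inj₁ refl)) (inj₂ (inj₂ refl)) _ = bc
    go (inj₂ (inj₁ refl)) (inj₁ refl) _ = adj-sym ab
    go (inj₂ (inj₂ refl)) (inj₁ refl) _ = adj-sym ac
    go (inj₂ (inj₂ refl)) (inj₂ (inj₁ refl)) _ = adj-sym bc
    go (inj₁ refl) (inj₁ refl) u≢v = ⊥-elim (u≢v refl)
    go (inj₂ (inj₁ refl)) (inj₂ (inj₁ refl)) u≢v = ⊥-elim (u≢v refl)
    go (inj₂ (inj₂ refl)) (inj₂ (inj₂ refl)) u≢v = ⊥-elim (u≢v refl)

  side-is-edge : (t : Tri) {x : Edge} → SideOf x t → IsEdge G (proj₁ x) (proj₂ x)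
  side-is-edge t (side u<v u∈t v∈t) = u<v , members-adjacent t u∈t v∈t (<⇒≢ u<v)

  side-cases : (t : Tri) {x : Edge} → SideOf x t →
    let ((a , b , c) , _) = t in (x ≡ (a , b)) ⊎ (x ≡ (a , c)) ⊎ (x ≡ (b , c))
  side-cases ((a , b , c) , ab , bc , _) (side uv p q) = go uv p q
    where
    go : ∀ {u v} → u < v → (u ≡ a) ⊎ (u ≡ b) ⊎ (u ≡ c) → (v ≡ a) ⊎ (v ≡ b) ⊎ (v ≡ c) →
      ((u , v) ≡ (a , b)) ⊎ ((u , v) ≡ (a , c)) ⊎ ((u , v) ≡ (b , c))
    go _ (inj₁ refl) (inj₂ (inj₁ refl)) = inj₁ refl
    go _ (inj₁ refl) (inj₂ (inj₂ refl)) = inj₂ (inj₁ refl)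
    go _ (inj₂ (inj₁ refl)) (inj₂ (inj₂ refl)) = inj₂ (inj₂ refl)
    go uv (inj₁ refl) (inj₁ refl) = ⊥-elim (<⇒≢ uv refl)
    go uv (inj₂ (inj₁ refl)) (inj₂ (inj₁ refl)) = ⊥-elim (<⇒≢ uv refl)
    go uv (inj₂ (inj₂ refl)) (inj₂ (inj₂ refl)) = ⊥-elim (<⇒≢ uv refl)
    go uv (inj₂ (inj₁ refl)) (inj₁ refl) = ⊥-elim (<-asym uv ab)
    go uv (inj₂ (inj₂ refl)) (inj₁ refl) = ⊥-elim (<-asym uv (<-trans ab bc))
    go uv (inj₂ (inj₂ refl)) (inj₂ (inj₁ refl)) = ⊥-elim (<-asym uv bc)

  record ThreeSides (t : Tri) : Set where
    field
      x₁ x₂ x₃ : Edge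
      side₁ : SideOf x₁ t
      side₂ : SideOf x₂ t
      side₃ : SideOf x₃ t
      x₁≢x₂ : x₁ ≢ x₂
      x₁≢x₃ : x₁ ≢ x₃
      x₂≢x₃ : x₂ ≢ x₃

  three-sides : (t : Tri) → ThreeSides t
  three-sides ((a , b , c) , ab , bc , _) = record
    { x₁ = a , b ; x₂ = a , c ; x₃ = b , c
    ; side₁ = side ab (inj₁ refl) (inj₂ (inj₁ refl))
    ; side₂ = side (<-trans ab bc) (inj₁ refl) (inj₂ (inj₂ refl))
    ; side₃ = side bc (inj₂ (inj₁ refl)) (inj₂ (inj₂ refl))
    ; x₁≢x₂ = λ e → <⇒≢ bc (cong proj₂ e)
    ; x₁≢x₃ = λ e → <⇒≢ ab (cong proj₁ e)
    ; x₂≢x₃ = λ e → <⇒≢ ab (cong proj₁ e) }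

  record Third (t : Tri) (u v : Fin n) : Set where
    field
      z     : Fin n
      z∈t   : z ∈△ t
      z≢u   : z ≢ u
      z≢v   : z ≢ v
      cover : ∀ {y} → y ∈△ t → (y ≡ u) ⊎ (y ≡ v) ⊎ (y ≡ z)

  third : (t : Tri) {u v : Fin n} → u ∈△ t → v ∈△ t → u ≢ v → Third t u v
  third ((a , b , c) , ab , bc , _) = go
    where
    ac : a < c
    ac = <-trans ab bc
    go : ∀ {u v} → (u ≡ a) ⊎ (u ≡ b) ⊎ (u ≡ c) → (v ≡ a) ⊎ (v ≡ b) ⊎ (v ≡ c) → u ≢ v →
      Third ((a , b , c) , ab , bc , _) u v
    go (inj₁ refl) (inj₂ (inj₁ refl)) _ = record
      { z = c ; z∈t = inj₂ (inj₂ refl) ; z≢u = ≢-sym (<⇒≢ ac) ; z≢v = ≢-sym (<⇒≢ bc)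
      ; cover = λ { (inj₁ e) → inj₁ e ; (inj₂ (inj₁ e)) → inj₂ (inj₁ e) ; (inj₂ (inj₂ e)) → inj₂ (inj₂ e) } }
    go (inj₁ refl) (inj₂ (inj₂ refl)) _ = record
      { z = b ; z∈t = inj₂ (inj₁ refl) ; z≢u = ≢-sym (<⇒≢ ab) ; z≢v = <⇒≢ bc
      ; cover = λ { (inj₁ e) → inj₁ e ; (inj₂ (inj₁ e)) → inj₂ (inj₂ e) ; (inj₂ (inj₂ e)) → inj₂ (inj₁ e) } }
    go (inj₂ (inj₁ refl)) (inj₁ refl) _ = record
      { z = c ; z∈t = inj₂ (inj₂ refl) ; z≢u = ≢-sym (<⇒≢ bc) ; z≢v = ≢-sym (<⇒≢ ac)
      ; cover = λ { (inj₁ e) → inj₂ (inj₁ e) ; (inj₂ (inj₁ e)) → inj₁ e ; (inj₂ (inj₂ e)) → inj₂ (inj₂ e) } }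
    go (inj₂ (inj₁ refl)) (inj₂ (inj₂ refl)) _ = record
      { z = a ; z∈t = inj₁ refl ; z≢u = <⇒≢ ab ; z≢v = <⇒≢ ac
      ; cover = λ { (inj₁ e) → inj₂ (inj₂ e) ; (inj₂ (inj₁ e)) → inj₁ e ; (inj₂ (inj₂ e)) → inj₂ (inj₁ e) } }
    go (inj₂ (inj₂ refl)) (inj₁ refl) _ = record
      { z = b ; z∈t = inj₂ (inj₁ refl) ; z≢u = <⇒≢ bc ; z≢v = ≢-sym (<⇒≢ ab)
      ; cover = λ { (inj₁ e) → inj₂ (inj₁ e) ; (inj₂ (inj₁ e)) → inj₂ (inj₂ e) ; (inj₂ (inj₂ e)) → inj₁ e } }
    go (inj₂ (inj₂ refl)) (inj₂ (inj₁ refl)) _ = record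
      { z = a ; z∈t = inj₁ refl ; z≢u = <⇒≢ ac ; z≢v = <⇒≢ ab
      ; cover = λ { (inj₁ e) → inj₂ (inj₂ e) ; (inj₂ (inj₁ e)) → inj₂ (inj₁ e) ; (inj₂ (inj₂ e)) → inj₁ e } }
    go (inj₁ refl) (inj₁ refl) u≢v = ⊥-elim (u≢v refl)
    go (inj₂ (inj₁ refl)) (inj₂ (inj₁ refl)) u≢v = ⊥-elim (u≢v refl)
    go (inj₂ (inj₂ refl)) (inj₂ (inj₂ refl)) u≢v = ⊥-elim (u≢v refl)

  _∈ₑ_ : Fin n → Edge → Set
  y ∈ₑ (p , q) = (y ≡ p) ⊎ (y ≡ q)

  ends-in : {s : Tri} {x : Edge} {y : Fin n} → SideOf x s → y ∈ₑ x → y ∈△ s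
  ends-in (side _ p∈s _) (inj₁ refl) = p∈s
  ends-in (side _ _ q∈s) (inj₂ refl) = q∈s

  private
    same-ends : {p q u v : Fin n} → u < v → p < q → p ∈ₑ (u , v) → q ∈ₑ (u , v) → (p , q) ≡ (u , v)
    same-ends u<v p<q (inj₁ refl) (inj₁ refl) = ⊥-elim (<⇒≢ p<q refl)
    same-ends u<v p<q (inj₁ refl) (inj₂ refl) = refl
    same-ends u<v p<q (inj₂ refl) (inj₁ refl) = ⊥-elim (<-asym u<v p<q)
    same-ends u<v p<q (inj₂ refl) (inj₂ refl) = ⊥-elim (<⇒≢ p<q refl)

  side-through-third : {t : Tri} {u v : Fin n} (th : Third t u v) → u < v →
    {x : Edge} → SideOf x t → x ≢ (u , v) → Third.z th ∈ₑ x
  side-through-third th u<v (side p<q p∈t q∈t) x≢uv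
    with assocˡ (Third.cover th p∈t) | assocˡ (Third.cover th q∈t)
  ... | inj₂ p≡z | _ = inj₁ (sym p≡z)
  ... | inj₁ _ | inj₂ q≡z = inj₂ (sym q≡z)
  ... | inj₁ p-end | inj₁ q-end = ⊥-elim (x≢uv (same-ends u<v p<q p-end q-end))

  two-sides⇒same : {t s : Tri} {x y : Edge} → x ≢ y →
    SideOf x t → SideOf y t → SideOf x s → SideOf y s → V t ≡ V s
  two-sides⇒same {t} {s} x≢y (side {u} {v} u<v u∈t v∈t) y-t (side _ u∈s v∈s) y-s =
    vertices-in⇒≡ t s λ _ y∈t → cases (Third.cover th y∈t)
    where
    th : Third t u v
    th = third t u∈t v∈t (<⇒≢ u<v)
    cases : ∀ {y} → (y ≡ u) ⊎ (y ≡ v) ⊎ (y ≡ Third.z th) → y ∈△ s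
    cases (inj₁ refl) = u∈s
    cases (inj₂ (inj₁ refl)) = v∈s
    cases (inj₂ (inj₂ refl)) = ends-in y-s (side-through-third th u<v y-t (≢-sym x≢y))

  shared-side⇒adjacent : {t s : Tri} {x : Edge} → V t ≢ V s → SideOf x t → SideOf x s → TAdj G t s
  shared-side⇒adjacent t≢s (side {u} {v} u<v u∈t v∈t) (side _ u∈s v∈s) =
    t≢s , u , v , u<v , u∈t , v∈t , u∈s , v∈s

  common-pair⇒adjacent : {t s : Tri} {u v : Fin n} → V t ≢ V s → u ≢ v →
    u ∈△ t → v ∈△ t → u ∈△ s → v ∈△ s → TAdj G t s
  common-pair⇒adjacent {t} {s} {u} {v} t≢s u≢v u∈t v∈t u∈s v∈s with <-cmp u v
  ... | tri< u<v _ _ = shared-side⇒adjacent {t} {s} t≢s (side u<v u∈t v∈t) (side u<v u∈s v∈s)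
  ... | tri≈ _ u≡v _ = ⊥-elim (u≢v u≡v)
  ... | tri> _ _ v<u = shared-side⇒adjacent {t} {s} t≢s (side v<u v∈t u∈t) (side v<u v∈s u∈s)

  triangle-through : (x y z : Fin n) → x ≢ y → x ≢ z → y ≢ z →
    adj G x y ≡ true → adj G x z ≡ true → adj G y z ≡ true → Σ Tri λ t → x ∈△ t × y ∈△ t × z ∈△ t
  triangle-through x y z x≢y x≢z y≢z xy xz yz with <-cmp x y | <-cmp y z | <-cmp x z
  ... | tri≈ _ e _ | _ | _ = ⊥-elim (x≢y e)
  ... | _ | tri≈ _ e _ | _ = ⊥-elim (y≢z e)
  ... | _ | _ | tri≈ _ e _ = ⊥-elim (x≢z e)
  ... | tri< x<y _ _ | tri< y<z _ _ | _ =
    ((x , y , z) , x<y , y<z , xy , xz , yz) , inj₁ refl , inj₂ (inj₁ refl) , inj₂ (inj₂ refl)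
  ... | tri< x<y _ _ | tri> _ _ z<y | tri< x<z _ _ =
    ((x , z , y) , x<z , z<y , xz , xy , adj-sym yz) , inj₁ refl , inj₂ (inj₂ refl) , inj₂ (inj₁ refl)
  ... | tri< x<y _ _ | tri> _ _ z<y | tri> _ _ z<x =
    ((z , x , y) , z<x , x<y , adj-sym xz , adj-sym yz , xy) , inj₂ (inj₁ refl) , inj₂ (inj₂ refl) , inj₁ refl
  ... | tri> _ _ y<x | tri< y<z _ _ | tri< x<z _ _ =
    ((y , x , z) , y<x , x<z , adj-sym xy , yz , xz) , inj₂ (inj₁ refl) , inj₁ refl , inj₂ (inj₂ refl)
  ... | tri> _ _ y<x | tri< y<z _ _ | tri> _ _ z<x =
    ((y , z , x) , y<z , z<x , yz , adj-sym xy , adj-sym xz) , inj₂ (inj₂ refl) , inj₁ refl , inj₂ (inj₁ refl)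
  ... | tri> _ _ y<x | tri> _ _ z<y | _ =
    ((z , y , x) , z<y , y<x , adj-sym yz , adj-sym xz , adj-sym xy) , inj₂ (inj₂ refl) , inj₂ (inj₁ refl) , inj₁ refl

  only-members : (t : Tri) {x y z w : Fin n} → x ≢ y → x ≢ z → y ≢ z →
    x ∈△ t → y ∈△ t → z ∈△ t → w ∈△ t → (w ≡ x) ⊎ (w ≡ y) ⊎ (w ≡ z)
  only-members t {x} {y} x≢y x≢z y≢z x∈t y∈t z∈t w∈t
    with Third.cover th w∈t | Third.cover th z∈t
    where
    th : Third t x y
    th = third t x∈t y∈t x≢y
  ... | inj₁ w≡x | _ = inj₁ w≡x
  ... | inj₂ (inj₁ w≡y) | _ = inj₂ (inj₁ w≡y)
  ... | inj₂ (inj₂ w≡o) | inj₂ (inj₂ z≡o) = inj₂ (inj₂ (trans w≡o (sym z≡o)))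
  ... | inj₂ (inj₂ _) | inj₁ z≡x = ⊥-elim (x≢z (sym z≡x))
  ... | inj₂ (inj₂ _) | inj₂ (inj₁ z≡y) = ⊥-elim (y≢z (sym z≡y))

  record K4InTG : Set where
    field
      t₁ t₂ t₃ t₄ : Tri
      adj₁₂ : TAdj G t₁ t₂
      adj₁₃ : TAdj G t₁ t₃
      adj₁₄ : TAdj G t₁ t₄
      adj₂₃ : TAdj G t₂ t₃
      adj₂₄ : TAdj G t₂ t₄
      adj₃₄ : TAdj G t₃ t₄

  -- A vertex w outside t but adjacent to all vertices of t spans with t a K₄ in G,
  -- whose four triangles (t and the three faces through w) are pairwise adjacent.
  apex⇒K4 : (t : Tri) (w : Fin n) → ¬ w ∈△ t → (∀ {x} → x ∈△ t → adj G x w ≡ true) → K4InTG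
  apex⇒K4 t@((a , b , c) , ab , bc , _) w w∉t w-adj = record
    { t₁ = t ; t₂ = T₂ ; t₃ = T₃ ; t₄ = T₄
    ; adj₁₂ = common-pair⇒adjacent {t} {T₂} (≢-sym (separated-by {T₂} {t} (w∈ fab) w∉t)) a≢b a∈ b∈ (u∈ fab) (v∈ fab)
    ; adj₁₃ = common-pair⇒adjacent {t} {T₃} (≢-sym (separated-by {T₃} {t} (w∈ fac) w∉t)) a≢c a∈ c∈ (u∈ fac) (v∈ fac)
    ; adj₁₄ = common-pair⇒adjacent {t} {T₄} (≢-sym (separated-by {T₄} {t} (w∈ fbc) w∉t)) b≢c b∈ c∈ (u∈ fbc) (v∈ fbc)
    ; adj₂₃ = common-pair⇒adjacent {T₂} {T₃} (separated-by {T₂} {T₃} (v∈ fab) (outside fac b∈ (≢-sym a≢b) b≢c))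
                (off a∈) (u∈ fab) (w∈ fab) (u∈ fac) (w∈ fac)
    ; adj₂₄ = common-pair⇒adjacent {T₂} {T₄} (separated-by {T₂} {T₄} (u∈ fab) (outside fbc a∈ a≢b a≢c))
                (off b∈) (v∈ fab) (w∈ fab) (u∈ fbc) (w∈ fbc)
    ; adj₃₄ = common-pair⇒adjacent {T₃} {T₄} (separated-by {T₃} {T₄} (u∈ fac) (outside fbc a∈ a≢b a≢c))
                (off c∈) (v∈ fac) (w∈ fac) (v∈ fbc) (w∈ fbc) }
    where
    a∈ : a ∈△ t
    a∈ = inj₁ refl
    b∈ : b ∈△ t
    b∈ = inj₂ (inj₁ refl)
    c∈ : c ∈△ t
    c∈ = inj₂ (inj₂ refl)
    a≢b : a ≢ b
    a≢b = <⇒≢ ab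
    b≢c : b ≢ c
    b≢c = <⇒≢ bc
    a≢c : a ≢ c
    a≢c = <⇒≢ (<-trans ab bc)
    off : ∀ {x} → x ∈△ t → x ≢ w
    off x∈t refl = w∉t x∈t
    record Face (u v : Fin n) : Set where
      field
        tri : Tri
        u∈ : u ∈△ tri
        v∈ : v ∈△ tri
        w∈ : w ∈△ tri
        u∈t : u ∈△ t
        v∈t : v ∈△ t
        u≢v : u ≢ v
    open Face
    face : ∀ {u v} → u ∈△ t → v ∈△ t → u ≢ v → Face u v
    face u∈t v∈t u≢v with triangle-through _ _ w u≢v (off u∈t) (off v∈t)
      (members-adjacent t u∈t v∈t u≢v) (w-adj u∈t) (w-adj v∈t)
    ... | s , u∈s , v∈s , w∈s = record
      { tri = s ; u∈ = u∈s ; v∈ = v∈s ; w∈ = w∈s ; u∈t = u∈t ; v∈t = v∈t ; u≢v = u≢v }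
    outside : ∀ {u v x} (f : Face u v) → x ∈△ t → x ≢ u → x ≢ v → ¬ x ∈△ tri f
    outside f x∈t x≢u x≢v x∈f
      with only-members (tri f) (u≢v f) (off (u∈t f)) (off (v∈t f)) (u∈ f) (v∈ f) (w∈ f) x∈f
    ... | inj₁ x≡u = x≢u x≡u
    ... | inj₂ (inj₁ x≡v) = x≢v x≡v
    ... | inj₂ (inj₂ x≡w) = off x∈t x≡w
    fab : Face a b
    fab = face a∈ b∈ a≢b
    fac : Face a c
    fac = face a∈ c∈ a≢c
    fbc : Face b c
    fbc = face b∈ c∈ b≢c
    T₂ T₃ T₄ : Tri
    T₂ = tri fab
    T₃ = tri fac
    T₄ = tri fbc

  -- If t shares distinct sides with triangles r₁ and r₂ (both other than t), and r₁
  -- and r₂ share a side, then the vertex of r₁ off t is an apex over t: a K₄ in G.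
  crossing⇒K4 : {t r₁ r₂ : Tri} {x₁ x₂ y : Edge} → x₁ ≢ x₂ →
    SideOf x₁ t → SideOf x₂ t → SideOf x₁ r₁ → SideOf x₂ r₂ → SideOf y r₁ → SideOf y r₂ →
    V r₁ ≢ V t → V r₂ ≢ V t → K4InTG
  crossing⇒K4 {t} {r₁} {r₂} {y = y} x₁≢x₂ x₁-t@(side {p} {q} p<q p∈t q∈t) x₂-t
    (side _ p∈r₁ q∈r₁) x₂-r₂ y-r₁ y-r₂ r₁≢t r₂≢t = apex⇒K4 t w w∉t w-adj
    where
    th : Third t p q
    th = third t p∈t q∈t (<⇒≢ p<q)
    th₁ : Third r₁ p q
    th₁ = third r₁ p∈r₁ q∈r₁ (<⇒≢ p<q)
    w : Fin n
    w = Third.z th₁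
    w∉t : ¬ w ∈△ t
    w∉t w∈t = r₁≢t (vertices-in⇒≡ r₁ t λ _ x∈r₁ → cases (Third.cover th₁ x∈r₁))
      where
      cases : ∀ {x} → (x ≡ p) ⊎ (x ≡ q) ⊎ (x ≡ w) → x ∈△ t
      cases (inj₁ refl) = p∈t
      cases (inj₂ (inj₁ refl)) = q∈t
      cases (inj₂ (inj₂ refl)) = w∈t
    z∈r₂ : Third.z th ∈△ r₂
    z∈r₂ = ends-in x₂-r₂ (side-through-third th p<q x₂-t (≢-sym x₁≢x₂))
    w∈r₂ : w ∈△ r₂
    w∈r₂ with y ≟ₑ (p , q)
    ... | yes refl = ⊥-elim (r₂≢t (sym (two-sides⇒same x₁≢x₂ x₁-t x₂-t y-r₂ x₂-r₂)))
    ... | no y≢pq = ends-in y-r₂ (side-through-third th₁ p<q y-r₁ y≢pq)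
    w-adj : ∀ {x} → x ∈△ t → adj G x w ≡ true
    w-adj x∈t with Third.cover th x∈t
    ... | inj₁ refl = members-adjacent r₁ p∈r₁ (Third.z∈t th₁) (≢-sym (Third.z≢u th₁))
    ... | inj₂ (inj₁ refl) = members-adjacent r₁ q∈r₁ (Third.z∈t th₁) (≢-sym (Third.z≢v th₁))
    ... | inj₂ (inj₂ refl) =
      members-adjacent r₂ z∈r₂ w∈r₂ (λ z≡w → w∉t (subst (_∈△ t) z≡w (Third.z∈t th)))

module Counting {A : Set} where

  count : {P : A → Set} → (∀ x → Dec (P x)) → List A → ℕ
  count P? [] = 0
  count P? (x ∷ xs) with P? x
  ... | yes _ = suc (count P? xs)
  ... | no _ = count P? xs

  count-mono : {P Q : A → Set} (P? : ∀ x → Dec (P x)) (Q? : ∀ x → Dec (Q x)) →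
    (∀ {x} → Q x → P x) → ∀ xs → count Q? xs ℕ.≤ count P? xs
  count-mono P? Q? Q⇒P [] = z≤n
  count-mono P? Q? Q⇒P (x ∷ xs) with P? x | Q? x
  ... | yes _ | yes _ = s≤s (count-mono P? Q? Q⇒P xs)
  ... | yes _ | no _ = ℕ.m≤n⇒m≤1+n (count-mono P? Q? Q⇒P xs)
  ... | no ¬p | yes q = contradiction (Q⇒P q) ¬p
  ... | no _ | no _ = count-mono P? Q? Q⇒P xs

  count-< : {P Q : A → Set} (P? : ∀ x → Dec (P x)) (Q? : ∀ x → Dec (Q x)) →
    (∀ {x} → Q x → P x) → ∀ {x₀} xs → x₀ ∈ xs → P x₀ → ¬ Q x₀ → count Q? xs ℕ.< count P? xs
  count-< P? Q? Q⇒P (x ∷ xs) (here refl) p ¬q with P? x | Q? x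
  ... | yes _ | yes q = contradiction q ¬q
  ... | yes _ | no _ = s≤s (count-mono P? Q? Q⇒P xs)
  ... | no ¬p | _ = contradiction p ¬p
  count-< P? Q? Q⇒P (x ∷ xs) (there x₀∈xs) p ¬q with P? x | Q? x
  ... | yes _ | yes _ = s≤s (count-< P? Q? Q⇒P xs x₀∈xs p ¬q)
  ... | yes _ | no _ = ℕ.m<n⇒m<1+n (count-< P? Q? Q⇒P xs x₀∈xs p ¬q)
  ... | no ¬p | yes q = contradiction (Q⇒P q) ¬p
  ... | no _ | no _ = count-< P? Q? Q⇒P xs x₀∈xs p ¬q

-- Breaker answers a Maker move on an edge reserved for a triangle he has not yet
-- blocked by claiming another edge reserved for it (any free edge otherwise).  Then
-- every triangle is blocked or still has all its reserved edges free, so Maker never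
-- owns a whole triangle.
module PairingStrategy {n : ℕ} (G : Graph n) where
  open Geometry G
  open Counting

  record Pairing (e₀ : Edge) : Set₁ where
    field
      Reserved      : Tri → Edge → Set
      reserved?     : ∀ t x → Dec (Reserved t x)
      reserved-side : ∀ {t x} → Reserved t x → SideOf x t
      e₀-unreserved : ∀ t → ¬ Reserved t e₀
      two-reserved  : ∀ t → Σ Edge λ x → Σ Edge λ y → x ≢ y × Reserved t x × Reserved t y
      exclusive     : ∀ {t s x} → Reserved t x → Reserved s x → V t ≡ V s

  module _ {e₀ : Edge} (π : Pairing e₀) where
    open Pairing π
    open import Data.List.Membership.DecPropositional _≟ₑ_ using (_∈?_)

    Blocked : Claims G → Tri → Set
    Blocked B t = Any (λ x → SideOf x t) B

    Free : Claims G → Claims G → Edge → Set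
    Free M B x = ¬ x ∈ M × ¬ x ∈ B

    Available : Claims G → Claims G → Edge → Set
    Available M B x = Unclaimed G M B (proj₁ x) (proj₂ x)

    -- The invariant of Breaker's strategy, in positions with Maker to move.
    record Safe (M B : Claims G) : Set where
      field
        maker-edges     : ∀ {x} → x ∈ M → IsEdge G (proj₁ x) (proj₂ x)
        claims-disjoint : ∀ {x} → x ∈ M → ¬ x ∈ B
        blocked-or-free : ∀ t → Blocked B t ⊎ (∀ {x} → Reserved t x → Free M B x)

    owned-triangle : {L : Claims G} → (∀ {x} → x ∈ L → IsEdge G (proj₁ x) (proj₂ x)) →
      MakerHasTriangle G L → Σ Tri λ t → ∀ {x} → SideOf x t → x ∈ L
    owned-triangle {L} edge (a , b , c , a<b , b<c , ab∈L , ac∈L , bc∈L) = t , owned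
      where
      t : Tri
      t = (a , b , c) , a<b , b<c , proj₂ (edge ab∈L) , proj₂ (edge ac∈L) , proj₂ (edge bc∈L)
      owned : ∀ {x} → SideOf x t → x ∈ L
      owned x-side with side-cases t x-side
      ... | inj₁ refl = ab∈L
      ... | inj₂ (inj₁ refl) = ac∈L
      ... | inj₂ (inj₂ refl) = bc∈L

    no-triangle : {L B : Claims G} → (∀ {x} → x ∈ L → IsEdge G (proj₁ x) (proj₂ x)) →
      (∀ {x} → x ∈ L → ¬ x ∈ B) → (∀ t → Blocked B t ⊎ Σ Edge (λ x → SideOf x t × ¬ x ∈ L)) →
      ¬ MakerHasTriangle G L
    no-triangle edge disjoint spare mt with owned-triangle edge mt
    ... | t , owned with spare t
    ...   | inj₁ blocked = let _ , x∈B , x-side = find blocked in disjoint (owned x-side) x∈B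
    ...   | inj₂ (_ , x-side , x∉L) = x∉L (owned x-side)

    reserved-besides : ∀ t e → Σ Edge λ x → x ≢ e × Reserved t x
    reserved-besides t e with two-reserved t
    ... | x , y , x≢y , rx , ry with x ≟ₑ e
    ...   | yes refl = y , ≢-sym x≢y , ry
    ...   | no x≢e = x , x≢e , rx

    ∉-∷ : {x e : Edge} {L : Claims G} → x ≢ e → ¬ x ∈ L → ¬ x ∈ e ∷ L
    ∉-∷ x≢e _ (here x≡e) = x≢e x≡e
    ∉-∷ _ x∉L (there x∈L) = x∉L x∈L

    blocked? : ∀ B t → Dec (Blocked B t)
    blocked? B t = Any.any? (λ x → side? x t) B

    module _ {M B : Claims G} (safe : Safe M B) where
      open Safe safe

      -- In a safe position Maker owns no triangle: a reserved side of each intact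
      -- triangle is free.
      safe⇒no-triangle : ¬ MakerHasTriangle G M
      safe⇒no-triangle = no-triangle maker-edges claims-disjoint spare
        where
        spare : ∀ t → Blocked B t ⊎ Σ Edge (λ x → SideOf x t × ¬ x ∈ M)
        spare t with blocked-or-free t
        ... | inj₁ blocked = inj₁ blocked
        ... | inj₂ free = let x , _ , rx = reserved-besides t e₀ in
          inj₂ (x , reserved-side rx , proj₁ (free rx))

      -- Nor after Maker's next move e: each intact triangle has a free reserved side besides e.
      move⇒no-triangle : ∀ {e} → Available M B e → ¬ MakerHasTriangle G (e ∷ M)
      move⇒no-triangle {e} (e-edge , _ , e∉B) = no-triangle edge disjoint spare
        where
        edge : ∀ {x} → x ∈ e ∷ M → IsEdge G (proj₁ x) (proj₂ x)
        edge (here refl) = e-edge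
        edge (there x∈M) = maker-edges x∈M
        disjoint : ∀ {x} → x ∈ e ∷ M → ¬ x ∈ B
        disjoint (here refl) = e∉B
        disjoint (there x∈M) = claims-disjoint x∈M
        spare : ∀ t → Blocked B t ⊎ Σ Edge (λ x → SideOf x t × ¬ x ∈ e ∷ M)
        spare t with blocked-or-free t
        ... | inj₁ blocked = inj₁ blocked
        ... | inj₂ free = let x , x≢e , rx = reserved-besides t e in
          inj₂ (x , reserved-side rx , ∉-∷ x≢e (proj₁ (free rx)))

      safe-step : ∀ {e b} → Available M B e → Available (e ∷ M) B b →
        (∀ t → ¬ Blocked (b ∷ B) t → ¬ Reserved t e) → Safe (e ∷ M) (b ∷ B)
      safe-step {e} {b} (e-edge , _ , e∉B) (_ , b∉eM , _) protects = record
        { maker-edges = edge ; claims-disjoint = disjoint ; blocked-or-free = blocked-or-free′ }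
        where
        edge : ∀ {x} → x ∈ e ∷ M → IsEdge G (proj₁ x) (proj₂ x)
        edge (here refl) = e-edge
        edge (there x∈M) = maker-edges x∈M
        disjoint : ∀ {x} → x ∈ e ∷ M → ¬ x ∈ b ∷ B
        disjoint x∈eM (here refl) = b∉eM x∈eM
        disjoint (here refl) (there x∈B) = e∉B x∈B
        disjoint (there x∈M) (there x∈B) = claims-disjoint x∈M x∈B
        blocked-or-free′ : ∀ t → Blocked (b ∷ B) t ⊎ (∀ {x} → Reserved t x → Free (e ∷ M) (b ∷ B) x)
        blocked-or-free′ t with blocked? (b ∷ B) t
        ... | yes blocked = inj₁ blocked
        ... | no intact with blocked-or-free t
        ...   | inj₁ blocked = contradiction (there blocked) intact
        ...   | inj₂ free = inj₂ λ {x} rx →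
          ∉-∷ (λ { refl → protects t intact rx }) (proj₁ (free rx)) ,
          ∉-∷ (λ { refl → intact (here (reserved-side rx)) }) (proj₂ (free rx))

    -- The number of vertex pairs claimed by neither player; every move lowers it.
    unclaimed : Claims G → Claims G → ℕ
    unclaimed M B = count (λ x → ¬? (x ∈? M) ×-dec ¬? (x ∈? B)) all-pairs
      where
      all-pairs : List Edge
      all-pairs = cartesianProduct (allFin n) (allFin n)

    claiming-lowers : ∀ {M B M′ B′} (x : Edge) → (∀ {y} → y ∈ M → y ∈ M′) → (∀ {y} → y ∈ B → y ∈ B′) →
      Free M B x → ¬ Free M′ B′ x → unclaimed M′ B′ ℕ.< unclaimed M B
    claiming-lowers (u , v) M⊆M′ B⊆B′ =
      count-< _ _ (λ (y∉M′ , y∉B′) → y∉M′ ∘ M⊆M′ , y∉B′ ∘ B⊆B′) _ (∈-cartesianProduct⁺ (∈-allFin u) (∈-allFin v))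

    available? : ∀ M B x → Dec (Available M B x)
    available? M B x@(u , v) = ((u <? v) ×-dec (adj G u v Bool.≟ true)) ×-dec ¬? (x ∈? M) ×-dec ¬? (x ∈? B)

    -- Breaker's strategy, by induction on a bound for the number of unclaimed pairs.
    mutual
      maker-turn : ∀ k {M B} → Safe M B → unclaimed M B ℕ.< k → BreakerWinsMakerToMove G M B
      maker-turn zero _ ()
      maker-turn (suc k) safe (s≤s bound) =
        makerMoves (safe⇒no-triangle safe) λ _ _ e-av → breaker-turn k safe e-av bound

      -- Maker has just claimed e.  If e is reserved for an intact triangle t, Breaker
      -- claims another edge reserved for t; otherwise any available edge, if there is one.
      breaker-turn : ∀ k {M B e} → Safe M B → Available M B e → unclaimed M B ℕ.≤ k →
        BreakerWinsBreakerToMove G (e ∷ M) B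
      breaker-turn k {M} {B} {e} safe e-av bound
        with any-triangle? (λ t → reserved? t e ×-dec ¬? (blocked? B t))
      ... | yes (t , re , intact) = answer k safe e-av bound b-av protects
        where
        open Safe safe
        b : Edge
        b = proj₁ (reserved-besides t e)
        b≢e : b ≢ e
        b≢e = proj₁ (proj₂ (reserved-besides t e))
        rb : Reserved t b
        rb = proj₂ (proj₂ (reserved-besides t e))
        b-av : Available (e ∷ M) B b
        b-av with blocked-or-free t
        ... | inj₁ blocked = contradiction blocked intact
        ... | inj₂ free = side-is-edge t (reserved-side rb) , ∉-∷ b≢e (proj₁ (free rb)) , proj₂ (free rb)
        protects : ∀ s → ¬ Blocked (b ∷ B) s → ¬ Reserved s e
        protects s s-intact rs = s-intact (here (transport (SideOf b) {t} {s} (exclusive re rs) (reserved-side rb)))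
      ... | no no-target with any? (λ u → any? λ v → available? (e ∷ M) B (u , v))
      ...   | yes (_ , _ , b-av) =
        answer k safe e-av bound b-av λ s s-intact rs → no-target (s , rs , s-intact ∘ there)
      ...   | no none = gameOver (move⇒no-triangle safe e-av) λ u v b-av → none (u , v , b-av)

      answer : ∀ k {M B e b} → Safe M B → Available M B e → unclaimed M B ℕ.≤ k →
        Available (e ∷ M) B b → (∀ t → ¬ Blocked (b ∷ B) t → ¬ Reserved t e) →
        BreakerWinsBreakerToMove G (e ∷ M) B
      answer k {M} {B} {e} {b} safe e-av@(_ , e∉M , e∉B) bound b-av@(_ , b∉eM , b∉B) protects =
        breakerMoves (move⇒no-triangle safe e-av) _ _ b-av
          (maker-turn k (safe-step safe e-av b-av protects) (ℕ.<-≤-trans lowered bound))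
        where
        lowered : unclaimed (e ∷ M) (b ∷ B) ℕ.< unclaimed M B
        lowered = ℕ.<-trans
          (claiming-lowers b (λ y → y) there (b∉eM , b∉B) (λ (_ , b∉bB) → b∉bB (here refl)))
          (claiming-lowers e there (λ y → y) (e∉M , e∉B) (λ (e∉eM , _) → e∉eM (here refl)))

    breaker-wins : ∀ e₁ → IsEdge G (proj₁ e₀) (proj₂ e₀) → IsEdge G (proj₁ e₁) (proj₂ e₁) →
      e₁ ≢ e₀ → BreakerWinsBreakerToMove G (e₁ ∷ e₀ ∷ []) []
    breaker-wins e₁ e₀-edge e₁-edge e₁≢e₀ =
      breaker-turn _ start (e₁-edge , ∉-∷ e₁≢e₀ (λ ()) , λ ()) ℕ.≤-refl
      where
      start : Safe (e₀ ∷ []) []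
      start = record
        { maker-edges = λ { (here refl) → e₀-edge }
        ; claims-disjoint = λ _ ()
        ; blocked-or-free = λ t → inj₂ λ rx → ∉-∷ (λ { refl → e₀-unreserved t rx }) (λ ()) , λ () }

-- Reserving for each triangle its sides other than e₀ that it does not share with a
-- lower triangle then defines a pairing: only one side per triangle is excluded, and a
-- side shared by two triangles is reserved at most for the lower one.
module Potentials {n : ℕ} (G : Graph n) where
  open Geometry G
  open PairingStrategy G

  record Potential (e₀ : Edge) : Set where
    field
      d : Tri → ℕ
      separating : ∀ {t s x} → V t ≢ V s → SideOf x t → SideOf x s → x ≢ e₀ → d t ≢ d s
      e₀-bottom : ∀ {t r y} → SideOf e₀ t → SideOf y t → SideOf y r → y ≢ e₀ → ¬ d r ℕ.< d t
      one-side-down : ∀ {t r₁ r₂ x₁ x₂} → x₁ ≢ x₂ → SideOf x₁ t → SideOf x₂ t →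
        SideOf x₁ r₁ → SideOf x₂ r₂ → d r₁ ℕ.< d t → ¬ d r₂ ℕ.< d t

  potential⇒pairing : ∀ {e₀} → Potential e₀ → Pairing e₀
  potential⇒pairing {e₀} P = record
    { Reserved = Reserved
    ; reserved? = λ t x → side? x t ×-dec ¬? (excluded? t x)
    ; reserved-side = proj₁
    ; e₀-unreserved = λ t (_ , not-excluded) → not-excluded (inj₁ refl)
    ; two-reserved = two-reserved
    ; exclusive = exclusive }
    where
    open Potential P
    Excluded : Tri → Edge → Set
    Excluded t x = (x ≡ e₀) ⊎ Σ Tri (λ r → SideOf x r × d r ℕ.< d t)

    excluded? : ∀ t x → Dec (Excluded t x)
    excluded? t x = (x ≟ₑ e₀) ⊎-dec any-triangle? (λ r → side? x r ×-dec (d r ℕ.<? d t))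

    Reserved : Tri → Edge → Set
    Reserved t x = SideOf x t × ¬ Excluded t x

    one-excluded : ∀ {t x y} → SideOf x t → SideOf y t → x ≢ y → Excluded t x → ¬ Excluded t y
    one-excluded _ _ x≢y (inj₁ refl) (inj₁ refl) = x≢y refl
    one-excluded e₀-t y-t x≢y (inj₁ refl) (inj₂ (r , y-r , r<t)) = e₀-bottom e₀-t y-t y-r (≢-sym x≢y) r<t
    one-excluded x-t e₀-t x≢y (inj₂ (r , x-r , r<t)) (inj₁ refl) = e₀-bottom e₀-t x-t x-r x≢y r<t
    one-excluded x-t y-t x≢y (inj₂ (r₁ , x-r₁ , r₁<t)) (inj₂ (r₂ , y-r₂ , r₂<t)) =
      one-side-down x≢y x-t y-t x-r₁ y-r₂ r₁<t r₂<t

    two-reserved : ∀ t → Σ Edge λ x → Σ Edge λ y → x ≢ y × Reserved t x × Reserved t y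
    two-reserved t with excluded? t x₁ | excluded? t x₂
      where open ThreeSides (three-sides t)
    ... | yes ex₁ | _ = x₂ , x₃ , x₂≢x₃ ,
      (side₂ , one-excluded side₁ side₂ x₁≢x₂ ex₁) , (side₃ , one-excluded side₁ side₃ x₁≢x₃ ex₁)
      where open ThreeSides (three-sides t)
    ... | no ¬ex₁ | yes ex₂ = x₁ , x₃ , x₁≢x₃ , (side₁ , ¬ex₁) , (side₃ , one-excluded side₂ side₃ x₂≢x₃ ex₂)
      where open ThreeSides (three-sides t)
    ... | no ¬ex₁ | no ¬ex₂ = x₁ , x₂ , x₁≢x₂ , (side₁ , ¬ex₁) , (side₂ , ¬ex₂)
      where open ThreeSides (three-sides t)

    -- A side shared by two different triangles is excluded from the higher one.
    exclusive : ∀ {t s x} → Reserved t x → Reserved s x → V t ≡ V s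
    exclusive {t} {s} (x-t , ¬ex-t) (x-s , ¬ex-s) with t ≟V s
    ... | yes t≡s = t≡s
    ... | no t≢s with ℕ.<-cmp (d t) (d s)
    ...   | tri< t<s _ _ = contradiction (inj₂ (t , x-t , t<s)) ¬ex-s
    ...   | tri≈ _ t≈s _ = contradiction t≈s (separating t≢s x-t x-s (¬ex-t ∘ inj₁))
    ...   | tri> _ _ s<t = contradiction (inj₂ (s , x-s , s<t)) ¬ex-t

module PathDistance where

  Consecutive : ℕ → ℕ → Set
  Consecutive i j = (suc i ≡ j) ⊎ (suc j ≡ i)

  private
    step-changes-distance : ∀ i k → ∣ i - k ∣ ≢ ∣ suc i - k ∣
    step-changes-distance zero zero ()
    step-changes-distance zero (suc k) eq = ℕ.1+n≢n eq
    step-changes-distance (suc i) zero eq = ℕ.1+n≢n (sym eq)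
    step-changes-distance (suc i) (suc k) = step-changes-distance i k

    not-both-closer : ∀ i k → ∣ i - k ∣ ℕ.< ∣ suc i - k ∣ → ¬ ∣ suc (suc i) - k ∣ ℕ.< ∣ suc i - k ∣
    not-both-closer i zero _ closer = ℕ.<-asym closer (ℕ.n<1+n (suc i))
    not-both-closer zero (suc k) closer _ = ℕ.<-asym closer (ℕ.n<1+n k)
    not-both-closer (suc i) (suc k) = not-both-closer i k

    step-from-root : ∀ k → ∣ k - suc k ∣ ≡ 1
    step-from-root zero = refl
    step-from-root (suc k) = step-from-root k

  consecutive-differ : ∀ {i j} k → Consecutive i j → ∣ i - k ∣ ≢ ∣ j - k ∣
  consecutive-differ {i} k (inj₁ refl) = step-changes-distance i k
  consecutive-differ {j = j} k (inj₂ refl) = ≢-sym (step-changes-distance j k)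

  neighbour-of-root : ∀ {i k} → Consecutive i k → ∣ i - k ∣ ≡ 1
  neighbour-of-root {i} (inj₁ refl) = step-from-root i
  neighbour-of-root {k = k} (inj₂ refl) = trans (ℕ.∣-∣-comm (suc k) k) (step-from-root k)

  one-neighbour-closer : ∀ {i j₁ j₂} k → Consecutive i j₁ → Consecutive i j₂ → j₁ ≢ j₂ →
    ∣ j₁ - k ∣ ℕ.< ∣ i - k ∣ → ¬ ∣ j₂ - k ∣ ℕ.< ∣ i - k ∣
  one-neighbour-closer k (inj₁ refl) (inj₁ refl) j₁≢j₂ = contradiction refl j₁≢j₂
  one-neighbour-closer k (inj₂ refl) (inj₂ refl) j₁≢j₂ = contradiction refl j₁≢j₂
  one-neighbour-closer {j₂ = j₂} k (inj₁ refl) (inj₂ refl) _ c₁ c₂ = not-both-closer j₂ k c₂ c₁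
  one-neighbour-closer {j₁ = j₁} k (inj₂ refl) (inj₁ refl) _ c₁ c₂ = not-both-closer j₁ k c₁ c₂

-- The distance along the path to a triangle A through e₀ is a
-- potential: triangles sharing a side sit at consecutive positions, which have different
-- distances; at most one neighbour of a position is closer; and the other triangles
-- through e₀ are neighbours of A, at distance 1.
module PathCase {n : ℕ} (G : Graph n) where
  open Geometry G
  open Potentials G
  open PathDistance

  module _ {k : ℕ} (f : Tri → Fin k) (inj : ∀ t s → f t ≡ f s → V t ≡ V s)
    (hom : ∀ t s → TAdj G t s → PathAdj k (f t) (f s)) (e₀ : Edge) where

    pos : Tri → ℕ
    pos t = toℕ (f t)

    neighbours-consecutive : ∀ {t s x} → V t ≢ V s → SideOf x t → SideOf x s → Consecutive (pos t) (pos s)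
    neighbours-consecutive {t} {s} t≢s x-t x-s = hom t s (shared-side⇒adjacent t≢s x-t x-s)

    same-position : ∀ {t s} → pos t ≡ pos s → V t ≡ V s
    same-position {t} {s} eq = inj t s (toℕ-injective eq)

    -- The distance to position c, where c is the position of a triangle through e₀ if any.
    distance-to : (c : ℕ) → (∀ {t} → SideOf e₀ t → Σ Tri λ A → SideOf e₀ A × pos A ≡ c) → Potential e₀
    distance-to c anchor = record
      { d = d
      ; separating = λ t≢s x-t x-s _ → consecutive-differ c (neighbours-consecutive t≢s x-t x-s)
      ; e₀-bottom = e₀-bottom
      ; one-side-down = one-side-down }
      where
      d : Tri → ℕ
      d t = ∣ pos t - c ∣

      lower⇒distinct : ∀ {t r} → d r ℕ.< d t → V t ≢ V r
      lower⇒distinct {t} {r} r<t t≡r = ℕ.<-irrefl (respects-V d {r} {t} (sym t≡r)) r<t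

      e₀-bottom : ∀ {t r y} → SideOf e₀ t → SideOf y t → SideOf y r → y ≢ e₀ → ¬ d r ℕ.< d t
      e₀-bottom {t} {r} e₀-t y-t y-r y≢e₀ r<t with anchor e₀-t
      ... | A , e₀-A , A-at-c with t ≟V A
      ...   | yes t≡A = ℕ.n≮0 (subst (d r ℕ.<_) (trans (respects-V d {t} {A} t≡A) (ℕ.m≡n⇒∣m-n∣≡0 A-at-c)) r<t)
      ...   | no t≢A = lower⇒distinct r<t (two-sides⇒same (≢-sym y≢e₀) e₀-t y-t e₀-r y-r)
        where
        r-at-c : pos r ≡ c
        r-at-c = ℕ.∣m-n∣≡0⇒m≡n (ℕ.n<1⇒n≡0 (subst (d r ℕ.<_)
          (neighbour-of-root (subst (Consecutive (pos t)) A-at-c (neighbours-consecutive t≢A e₀-t e₀-A))) r<t))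
        e₀-r : SideOf e₀ r
        e₀-r = transport (SideOf e₀) {A} {r} (same-position (trans A-at-c (sym r-at-c))) e₀-A

      one-side-down : ∀ {t r₁ r₂ x₁ x₂} → x₁ ≢ x₂ → SideOf x₁ t → SideOf x₂ t →
        SideOf x₁ r₁ → SideOf x₂ r₂ → d r₁ ℕ.< d t → ¬ d r₂ ℕ.< d t
      one-side-down {t} {r₁} {r₂} {x₂ = x₂} x₁≢x₂ x₁-t x₂-t x₁-r₁ x₂-r₂ r₁<t r₂<t with pos r₁ ℕ.≟ pos r₂
      ... | yes same = lower⇒distinct r₁<t
        (two-sides⇒same x₁≢x₂ x₁-t x₂-t x₁-r₁ (transport (SideOf x₂) {r₂} {r₁} (same-position (sym same)) x₂-r₂))
      ... | no differ = one-neighbour-closer c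
        (neighbours-consecutive (lower⇒distinct r₁<t) x₁-t x₁-r₁)
        (neighbours-consecutive (lower⇒distinct r₂<t) x₂-t x₂-r₂) differ r₁<t r₂<t

    path-potential : Potential e₀
    path-potential with any-triangle? (side? e₀)
    ... | yes (A , e₀-A) = distance-to (pos A) (λ _ → A , e₀-A , refl)
    ... | no none = distance-to 0 (λ {t} e₀-t → contradiction (t , e₀-t) none)

module K3+ where

  ends : Fin 4 → Fin 4 × Fin 4
  ends zero = zero , suc zero
  ends (suc zero) = zero , suc (suc zero)
  ends (suc (suc zero)) = suc zero , suc (suc zero)
  ends (suc (suc (suc zero))) = zero , suc (suc (suc zero))

  edge-index : Fin 4 → Fin 4 → Maybe (Fin 4)
  edge-index zero (suc zero) = just zero
  edge-index (suc zero) zero = just zero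
  edge-index zero (suc (suc zero)) = just (suc zero)
  edge-index (suc (suc zero)) zero = just (suc zero)
  edge-index (suc zero) (suc (suc zero)) = just (suc (suc zero))
  edge-index (suc (suc zero)) (suc zero) = just (suc (suc zero))
  edge-index zero (suc (suc (suc zero))) = just (suc (suc (suc zero)))
  edge-index (suc (suc (suc zero))) zero = just (suc (suc (suc zero)))
  edge-index _ _ = nothing

  k3+? : ∀ u v → Dec (K3+Adj u v)
  k3+? u v = one-way u v ⊎-dec one-way v u
    where
    one-way : ∀ u v → Dec (((toℕ u ≡ 0) × (toℕ v ≡ 1)) ⊎ ((toℕ u ≡ 0) × (toℕ v ≡ 2))
                           ⊎ ((toℕ u ≡ 1) × (toℕ v ≡ 2)) ⊎ ((toℕ u ≡ 0) × (toℕ v ≡ 3)))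
    one-way u v = ((toℕ u ℕ.≟ 0) ×-dec (toℕ v ℕ.≟ 1)) ⊎-dec ((toℕ u ℕ.≟ 0) ×-dec (toℕ v ℕ.≟ 2))
                  ⊎-dec ((toℕ u ℕ.≟ 1) ×-dec (toℕ v ℕ.≟ 2)) ⊎-dec ((toℕ u ℕ.≟ 0) ×-dec (toℕ v ℕ.≟ 3))

  private
    _≟ₘ_ : (x y : Maybe (Fin 4)) → Dec (x ≡ y)
    _≟ₘ_ = Maybe.≡-dec _≟_

    _≟²_ : (x y : Fin 4 × Fin 4) → Dec (x ≡ y)
    _≟²_ = Product.≡-dec _≟_ _≟_

  adjacent⇒edge : ∀ p q → K3+Adj p q → Σ (Fin 4) λ i → edge-index p q ≡ just i
  adjacent⇒edge = toWitness {a? = all? λ p → all? λ q → k3+? p q →-dec any? λ i → edge-index p q ≟ₘ just i} tt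

  edge-index-ends : ∀ p q i → edge-index p q ≡ just i → (ends i ≡ (p , q)) ⊎ (ends i ≡ (q , p))
  edge-index-ends = toWitness {a? = all? λ p → all? λ q → all? λ i →
    (edge-index p q ≟ₘ just i) →-dec ((ends i ≟² (p , q)) ⊎-dec (ends i ≟² (q , p)))} tt

  no-K4 : ∀ p q r s → K3+Adj p q → K3+Adj p r → K3+Adj p s → K3+Adj q r → K3+Adj q s → K3+Adj r s → ⊥
  no-K4 p q r s pq pr ps qr qs rs = toWitness {a? = all? λ p → all? λ q → all? λ r → all? λ s →
    ¬? (k3+? p q ×-dec k3+? p r ×-dec k3+? p s ×-dec k3+? q r ×-dec k3+? q s ×-dec k3+? r s)}
    tt p q r s (pq , pr , ps , qr , qs , rs)

  -- A configuration of K3+ consists of the set R of (indices of) realised edges and the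
  -- set S of source vertices; Rel R is the realised adjacency relation.
  Realised : Subset 4 → Maybe (Fin 4) → Set
  Realised R nothing = ⊥
  Realised R (just i) = T (lookup R i)

  Rel : Subset 4 → Fin 4 → Fin 4 → Set
  Rel R p q = Realised R (edge-index p q)

  Src : Subset 4 → Fin 4 → Set
  Src S p = T (lookup S p)

  -- Distinct sources are related (in the application they share the edge e₀).
  Consistent : Subset 4 → Subset 4 → Set
  Consistent R S = ∀ p q → Src S p → Src S q → p ≢ q → Rel R p q

  -- The conditions on a potential, transferred to the labels of K3+.
  Admissible : Subset 4 → Subset 4 → (Fin 4 → ℕ) → Set
  Admissible R S d =
    (∀ p q → Rel R p q → d p ≡ d q → Src S p × Src S q) ×
    (∀ p q → Src S p → Rel R p q → d q ℕ.< d p → Src S q) ×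
    (∀ p q₁ q₂ → Rel R p q₁ → Rel R p q₂ → q₁ ≢ q₂ → d q₁ ℕ.< d p → d q₂ ℕ.< d p → Rel R q₁ q₂)

  rankings : List (Vec ℕ 4)
  rankings = (0 ∷ 1 ∷ 2 ∷ 3 ∷ []) ∷ (2 ∷ 1 ∷ 0 ∷ 3 ∷ []) ∷ (1 ∷ 3 ∷ 2 ∷ 0 ∷ []) ∷ (1 ∷ 0 ∷ 2 ∷ 3 ∷ [])
           ∷ (1 ∷ 2 ∷ 0 ∷ 3 ∷ []) ∷ (2 ∷ 0 ∷ 1 ∷ 3 ∷ []) ∷ (0 ∷ 2 ∷ 1 ∷ 3 ∷ []) ∷ (1 ∷ 2 ∷ 3 ∷ 0 ∷ []) ∷ []

  private
    rel? : ∀ R p q → Dec (Rel R p q)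
    rel? R p q with edge-index p q
    ... | nothing = no λ ()
    ... | just i = T? (lookup R i)

    src? : ∀ S p → Dec (Src S p)
    src? S p = T? (lookup S p)

    consistent? : ∀ R S → Dec (Consistent R S)
    consistent? R S = all? λ p → all? λ q → src? S p →-dec src? S q →-dec ¬? (p ≟ q) →-dec rel? R p q

    admissible? : ∀ R S d → Dec (Admissible R S d)
    admissible? R S d =
      (all? λ p → all? λ q → rel? R p q →-dec d p ℕ.≟ d q →-dec src? S p ×-dec src? S q) ×-dec
      (all? λ p → all? λ q → src? S p →-dec rel? R p q →-dec d q ℕ.<? d p →-dec src? S q) ×-dec
      (all? λ p → all? λ q₁ → all? λ q₂ → rel? R p q₁ →-dec rel? R p q₂ →-dec ¬? (q₁ ≟ q₂) →-dec
         d q₁ ℕ.<? d p →-dec d q₂ ℕ.<? d p →-dec rel? R q₁ q₂)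

    all-subsets? : {P : Subset 4 → Set} → (∀ s → Dec (P s)) → Dec (∀ s → P s)
    all-subsets? P? = map′ (λ ¬∃¬ s → decidable-stable (P? s) λ ¬p → ¬∃¬ (s , ¬p)) (λ ∀P (s , ¬p) → ¬p (∀P s))
      (¬? (anySubset? λ s → ¬? (P? s)))

  admissible-ranking : ∀ R S → Consistent R S → Any (λ r → Admissible R S (lookup r)) rankings
  admissible-ranking = toWitness {a? = all-subsets? λ R → all-subsets? λ S →
    consistent? R S →-dec Any.any? (λ r → admissible? R S (lookup r)) rankings} tt

-- Record which edges of K3+ are realised by triangles sharing
-- a side and which labels carry a triangle through e₀; the ranking provided by
-- admissible-ranking, composed with f, is a potential.  The realised relation cannot
-- hide a K₄ of T_G because K3+ has none.
module K3+Case {n : ℕ} (G : Graph n) where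
  open Geometry G
  open Potentials G
  open K3+

  module _ (f : Tri → Fin 4) (inj : ∀ t s → f t ≡ f s → V t ≡ V s)
    (hom : ∀ t s → TAdj G t s → K3+Adj (f t) (f s)) (e₀ : Edge) where

    Linked : Fin 4 → Fin 4 → Set
    Linked p q = Σ Tri λ t → Σ Tri λ s → f t ≡ p × f s ≡ q × V t ≢ V s × Σ Edge λ x → SideOf x t × SideOf x s

    Source : Fin 4 → Set
    Source p = Σ Tri λ t → f t ≡ p × SideOf e₀ t

    linked? : ∀ p q → Dec (Linked p q)
    linked? p q = any-triangle? λ t → any-triangle? λ s → (f t ≟ p) ×-dec (f s ≟ q) ×-dec ¬? (t ≟V s) ×-dec
      any-edge? λ x → side? x t ×-dec side? x s
      where
      any-edge? : {P : Edge → Set} → (∀ x → Dec (P x)) → Dec (Σ Edge P)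
      any-edge? P? = map′ (λ (u , v , p) → (u , v) , p) (λ ((u , v) , p) → u , v , p) (any? λ u → any? λ v → P? (u , v))

    source? : ∀ p → Dec (Source p)
    source? p = any-triangle? λ t → (f t ≟ p) ×-dec side? e₀ t

    linked-sym : ∀ {p q} → Linked p q → Linked q p
    linked-sym (t , s , ft , fs , t≢s , x , x-t , x-s) = s , t , fs , ft , ≢-sym t≢s , x , x-s , x-t

    record Describes (R S : Subset 4) : Set where
      field
        rel-sound    : ∀ {p q} → Rel R p q → Linked p q
        rel-complete : ∀ {p q} → Linked p q → Rel R p q
        src-sound    : ∀ {p} → Src S p → Source p
        src-complete : ∀ {p} → Source p → Src S p

    description : Σ (Subset 4) λ R → Σ (Subset 4) λ S → Describes R S
    description = R , S , record
      { rel-sound = rel-sound ; rel-complete = rel-complete ; src-sound = src-sound ; src-complete = src-complete }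
      where
      realised-bit source-bit : Fin 4 → Bool
      realised-bit i = isYes (linked? (proj₁ (ends i)) (proj₂ (ends i)))
      source-bit p = isYes (source? p)

      R S : Subset 4
      R = tabulate realised-bit
      S = tabulate source-bit

      src-sound : ∀ {p} → Src S p → Source p
      src-sound {p} h = toWitness {a? = source? p} (subst T (lookup∘tabulate source-bit p) h)

      src-complete : ∀ {p} → Source p → Src S p
      src-complete {p} h = subst T (sym (lookup∘tabulate source-bit p)) (fromWitness {a? = source? p} h)

      linked-ends⇒ : ∀ {i p q} → (ends i ≡ (p , q)) ⊎ (ends i ≡ (q , p)) → uncurry Linked (ends i) → Linked p q
      linked-ends⇒ (inj₁ refl) l = l
      linked-ends⇒ (inj₂ refl) l = linked-sym l

      ⇒linked-ends : ∀ {i p q} → (ends i ≡ (p , q)) ⊎ (ends i ≡ (q , p)) → Linked p q → uncurry Linked (ends i)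
      ⇒linked-ends (inj₁ refl) l = l
      ⇒linked-ends (inj₂ refl) l = linked-sym l

      rel-sound : ∀ {p q} → Rel R p q → Linked p q
      rel-sound {p} {q} r with edge-index p q in eq
      ... | just i = linked-ends⇒ (edge-index-ends p q i eq)
        (toWitness {a? = linked? _ _} (subst T (lookup∘tabulate realised-bit i) r))

      rel-complete : ∀ {p q} → Linked p q → Rel R p q
      rel-complete {p} {q} l@(t , s , refl , refl , t≢s , _ , x-t , x-s)
        with adjacent⇒edge p q (hom t s (shared-side⇒adjacent {t} {s} t≢s x-t x-s))
      ... | i , eq rewrite eq = subst T (sym (lookup∘tabulate realised-bit i))
        (fromWitness {a? = linked? _ _} (⇒linked-ends (edge-index-ends p q i eq) l))

    no-K4-in-T_G : ¬ K4InTG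
    no-K4-in-T_G k4 = no-K4 (f t₁) (f t₂) (f t₃) (f t₄)
      (hom t₁ t₂ adj₁₂) (hom t₁ t₃ adj₁₃) (hom t₁ t₄ adj₁₄) (hom t₂ t₃ adj₂₃) (hom t₂ t₄ adj₂₄) (hom t₃ t₄ adj₃₄)
      where open K4InTG k4

    module _ {R S : Subset 4} (D : Describes R S) where
      open Describes D

      consistent : Consistent R S
      consistent p q src-p src-q p≢q with src-sound {p} src-p | src-sound {q} src-q
      ... | t , refl , e₀-t | s , refl , e₀-s =
        rel-complete (t , s , refl , refl , (λ t≡s → p≢q (respects-V f {t} {s} t≡s)) , e₀ , e₀-t , e₀-s)

      source⇒e₀ : ∀ {t} → Src S (f t) → SideOf e₀ t
      source⇒e₀ {t} src with src-sound src
      ... | t′ , ft′ , e₀-t′ = transport (SideOf e₀) {t′} {t} (inj t′ t ft′) e₀-t′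

      linked : ∀ {t s x} → V t ≢ V s → SideOf x t → SideOf x s → Rel R (f t) (f s)
      linked {t} {s} {x} t≢s x-t x-s = rel-complete (t , s , refl , refl , t≢s , x , x-t , x-s)
      labelled-potential : (d : Fin 4 → ℕ) → Admissible R S d → Potential e₀
      labelled-potential d (equal⇒sources , below-source⇒source , lower⇒linked) = record
        { d = d ∘ f ; separating = separating ; e₀-bottom = e₀-bottom ; one-side-down = one-side-down }
        where
        lower⇒distinct : ∀ {t r} → d (f r) ℕ.< d (f t) → V t ≢ V r
        lower⇒distinct {t} {r} r<t t≡r = ℕ.<-irrefl (respects-V (d ∘ f) {r} {t} (sym t≡r)) r<t

        separating : ∀ {t s x} → V t ≢ V s → SideOf x t → SideOf x s → x ≢ e₀ → d (f t) ≢ d (f s)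
        separating {t} {s} t≢s x-t x-s x≢e₀ eq with equal⇒sources (f t) (f s) (linked t≢s x-t x-s) eq
        ... | src-t , src-s = t≢s (two-sides⇒same (≢-sym x≢e₀) (source⇒e₀ src-t) x-t (source⇒e₀ src-s) x-s)

        e₀-bottom : ∀ {t r y} → SideOf e₀ t → SideOf y t → SideOf y r → y ≢ e₀ → ¬ d (f r) ℕ.< d (f t)
        e₀-bottom {t} {r} e₀-t y-t y-r y≢e₀ r<t =
          lower⇒distinct r<t (two-sides⇒same (≢-sym y≢e₀) e₀-t y-t (source⇒e₀ src-r) y-r)
          where
          src-r : Src S (f r)
          src-r = below-source⇒source (f t) (f r) (src-complete (t , refl , e₀-t))
            (linked (lower⇒distinct r<t) y-t y-r) r<t

        one-side-down : ∀ {t r₁ r₂ x₁ x₂} → x₁ ≢ x₂ → SideOf x₁ t → SideOf x₂ t →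
          SideOf x₁ r₁ → SideOf x₂ r₂ → d (f r₁) ℕ.< d (f t) → ¬ d (f r₂) ℕ.< d (f t)
        one-side-down {t} {r₁} {r₂} {x₂ = x₂} x₁≢x₂ x₁-t x₂-t x₁-r₁ x₂-r₂ r₁<t r₂<t with f r₁ ≟ f r₂
        ... | yes same = lower⇒distinct r₁<t
          (two-sides⇒same x₁≢x₂ x₁-t x₂-t x₁-r₁ (transport (SideOf x₂) {r₂} {r₁} (inj r₂ r₁ (sym same)) x₂-r₂))
        ... | no differ with rel-sound (lower⇒linked (f t) (f r₁) (f r₂)
              (linked (lower⇒distinct r₁<t) x₁-t x₁-r₁) (linked (lower⇒distinct r₂<t) x₂-t x₂-r₂) differ r₁<t r₂<t)
        ...   | r₁′ , r₂′ , r₁′-label , r₂′-label , _ , y , y-r₁′ , y-r₂′ = no-K4-in-T_G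
          (crossing⇒K4 x₁≢x₂ x₁-t x₂-t x₁-r₁ x₂-r₂
            (transport (SideOf y) {r₁′} {r₁} (inj r₁′ r₁ r₁′-label) y-r₁′)
            (transport (SideOf y) {r₂′} {r₂} (inj r₂′ r₂ r₂′-label) y-r₂′)
            (≢-sym (lower⇒distinct r₁<t)) (≢-sym (lower⇒distinct r₂<t)))

    K3+-potential : Potential e₀
    K3+-potential = let R , S , D = description
                        ranking , admissible = Any.satisfied (admissible-ranking R S (consistent D))
                    in labelled-potential D (lookup ranking) admissible

proposition16 : (n : ℕ) (G : Graph n) → NoIsolatedVertices G → VeryBasic G →
    (u₁ v₁ u₂ v₂ : Fin n) → IsEdge G u₁ v₁ → IsEdge G u₂ v₂ → (u₁ , v₁) ≢ (u₂ , v₂) →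
    BreakerWinsBreakerToMove G ((u₁ , v₁) ∷ (u₂ , v₂) ∷ []) []
proposition16 n G _ very-basic u₁ v₁ u₂ v₂ e₁-edge e₀-edge e₁≢e₀ =
  breaker-wins (potential⇒pairing (potential very-basic)) (u₁ , v₁) e₀-edge e₁-edge e₁≢e₀
  where
  open PairingStrategy G
  open Potentials G
  potential : VeryBasic G → Potential (u₂ , v₂)
  potential (inj₁ (f , inj , hom)) = K3+Case.K3+-potential G f inj hom (u₂ , v₂)
  potential (inj₂ (k , f , inj , hom)) = PathCase.path-potential G f inj hom (u₂ , v₂)
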